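{- Let $\mathfrak{R}_A=(\mathfrak{R}_a)_{a\in A}$ be a family of $S5$-modal relations. For every formula $\phi$, if there is a base $\mathscr{B}$ with $\nVdash_{\mathscr{B},\mathfrak{R}_A}\phi$, then there is a maximally-consistent base $\mathscr{C}\supseteq\mathscr{B}$ with $\nVdash_{\mathscr{C},\mathfrak{R}_A}\phi$.
   Context: Fix a countably infinite set of atomic formulae and a nonempty set $A$ of agents. Formulae: $\phi ::= p \mid \bot \mid \phi\to\phi \mid K_a\phi$ with $p$ atomic and $a\in A$. A base rule is written $p_1,\dots,p_n\Rightarrow p$, where $\{p_1,\dots,p_n\}$ is a finite (possibly empty) set of atoms and $p$ is an atom. A base is a countable set of base rules; $\Omega$ is the set of all bases. $\overline{\mathscr{B}}$ is the smallest set of atoms closed under the rules of $\mathscr{B}$. A base $\mathscr{B}$ is inconsistent iff every atom lies in $\overline{\mathscr{B}}$, and consistent otherwise. A base $\mathscr{B}$ is maximally-consistent iff it is consistent and for every base rule $\delta$, either $\delta\in\mathscr{B}$ or $\mathscr{B}\cup\{\delta\}$ is inconsistent. An $S5$-modal relation is a binary relation $\mathfrak{R}$ on $\Omega$ that is reflexive, transitive and Euclidean (if $\mathfrak{R}\mathscr{B}\mathscr{C}$ and $\mathfrak{R}\mathscr{B}\mathscr{D}$ then $\mathfrak{R}\mathscr{C}\mathscr{D}$) and satisfies, for all bases $\mathscr{B}$: (a) if $\mathscr{B}$ is inconsistent, there is an inconsistent $\mathscr{C}$ with $\mathfrak{R}\mathscr{B}\mathscr{C}$, and every $\mathscr{D}$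 with $\mathfrak{R}\mathscr{B}\mathscr{D}$ is inconsistent; (b) if $\mathscr{B}$ is consistent, every $\mathscr{C}$ with $\mathfrak{R}\mathscr{B}\mathscr{C}$ is consistent; (c) for all $\mathscr{C}$, if $\mathfrak{R}\mathscr{B}\mathscr{C}$ then for every consistent $\mathscr{D}\supseteq\mathscr{B}$ there is $\mathscr{E}\supseteq\mathscr{C}$ with $\mathfrak{R}\mathscr{D}\mathscr{E}$; (d) for all consistent $\mathscr{C}$, if $\mathfrak{R}\mathscr{B}\mathscr{C}$ then for every $\mathscr{D}\subseteq\mathscr{B}$ there is $\mathscr{E}\subseteq\mathscr{C}$ with $\mathfrak{R}\mathscr{D}\mathscr{E}$. For a family $\mathfrak{R}_A=(\mathfrak{R}_a)_{a\in A}$ of $S5$-modal relations, validity at a base is defined inductively: $\Vdash_{\mathscr{B},\mathfrak{R}_A}p$ iff $p\in\overline{\mathscr{B}}$; $\Vdash_{\mathscr{B},\mathfrak{R}_A}\phi\to\psi$ iff $\phi\Vdash_{\mathscr{B},\mathfrak{R}_A}\psi$; $\Vdash_{\mathscr{B},\mathfrak{R}_A}\bot$ iff $\Vdash_{\mathscr{B},\mathfrak{R}_A}p$ for every atom $p$; $\Vdash_{\mathscr{B},\mathfrak{R}_A}K_a\phi$ iff $\Vdash_{\mathscr{C},\mathfrak{R}_A}\phi$ for all $\mathscr{C}$ with $\mathfrak{R}_a\mathscr{B}\mathscr{C}$; and for a nonempty set $\Gamma$ of formulae, $\Gamma\Vdash_{\mathscr{B},\mathfrak{R}_A}\phi$ iff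 for every $\mathscr{C}\supseteq\mathscr{B}$, if $\Vdash_{\mathscr{C},\mathfrak{R}_A}\psi$ for all $\psi\in\Gamma$ then $\Vdash_{\mathscr{C},\mathfrak{R}_A}\phi$. -}

module Defs where

open import Level using (Level; 0ℓ; suc)
open import Data.Nat using (ℕ; _<_)
open import Data.List using (List)
open import Data.List.Membership.Propositional using (_∈_)
open import Data.List.Relation.Unary.Linked using (Linked)
open import Data.Product using (Σ; _×_)
open import Data.Sum using (_⊎_)
open import Relation.Nullary using (¬_)
open import Relation.Binary.PropositionalEquality using (_≡_)

Atom : Set
Atom = ℕ

data Formula (A : Set) : Set where
  atom : Atom → Formula A
  ⊥'   : Formula A
  _⇒_  : Formula A → Formula A → Formula A
  K    : A → Formula A → Formula A

-- A base rule  p₁,…,pₙ ⇒ p.  The finite set of premises {p₁,…,pₙ} is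
-- represented canonically as a strictly increasing list of atoms, so that
-- two rules are equal iff they have the same premise SET and conclusion.
record Rule : Set where
  constructor rule
  field
    prems  : List Atom
    sorted : Linked _<_ prems
    concl  : Atom
open Rule public

-- A base: a set of base rules (every set of rules is countable, since
-- there are only countably many rules).  Ω is the type Base.
Base : Set₁
Base = Rule → Set

_⊆_ : Base → Base → Set
B ⊆ C = ∀ r → B r → C r

_∪｛_｝ : Base → Rule → Base
(B ∪｛ δ ｝) r = B r ⊎ r ≡ δ

data Closure (B : Base) : Atom → Set where
  step : (r : Rule) → B r → (∀ q → q ∈ prems r → Closure B q) → Closure B (concl r)

Inconsistent : Base → Set
Inconsistent B = ∀ p → Closure B p

Consistent : Base → Set
Consistent B = ¬ Inconsistent B

MaximallyConsistent : Base → Set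
MaximallyConsistent B =
  Consistent B × (∀ (δ : Rule) → B δ ⊎ Inconsistent (B ∪｛ δ ｝))

Relation : Set₁
Relation = Base → Base → Set

record IsS5 (R : Relation) : Set₁ where
  field
    refl      : ∀ B → R B B
    trans     : ∀ B C D → R B C → R C D → R B D
    euclidean : ∀ B C D → R B C → R B D → R C D
    condA     : ∀ B → Inconsistent B →
                  Σ Base (λ C → Inconsistent C × R B C)
                  × (∀ D → R B D → Inconsistent D)
    condB     : ∀ B → Consistent B → ∀ C → R B C → Consistent C
    condC     : ∀ B C → R B C → ∀ D → Consistent D → B ⊆ D →
                  Σ Base (λ E → C ⊆ E × R D E)
    condD     : ∀ B C → Consistent C → R B C → ∀ D → D ⊆ B →
                  Σ Base (λ E → E ⊆ C × R D E)

-- Validity  ⊩_{B,R_A} φ.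
-- The implication clause uses the singleton-context entailment
-- {φ} ⊩_B ψ : for every C ⊇ B, ⊩_C φ implies ⊩_C ψ.
⊩ : {A : Set} → (A → Relation) → Base → Formula A → Set₁
⊩ R B (atom p) = Level.Lift (suc 0ℓ) (Closure B p)
⊩ R B ⊥'       = ∀ p → ⊩ R B (atom p)
⊩ R B (φ ⇒ ψ)  = ∀ C → B ⊆ C → ⊩ R C φ → ⊩ R C ψ
⊩ R B (K a φ)  = ∀ C → R a B C → ⊩ R C φ

-- Atoms and ⊥ are refuted already at the completion Adm B of B (all rules admissible in B),
-- which is maximally consistent and has the same closure as B.  An implication or a
-- K-formula is refuted at B by a counterexample base C (an extension of B, resp. an
-- R_a-successor), and induction yields a maximally consistent C' ⊇ C refuting the
-- relevant subformula.  For K a φ the S5 conditions transport R_a C B along C ⊆ C' to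
-- some E ⊇ B with R_a C' E, and from any consistent extension of E (such as Adm E) one
-- reaches a sub-base of C' by R_a, since maximal consistency makes every consistent
-- extension of C' equal to C'.
module Submission where

open import Defs
open import Level using (0ℓ; suc; lift; lower)
open import Axiom.ExcludedMiddle using (ExcludedMiddle)
open import Axiom.DoubleNegationElimination using (DoubleNegationElimination; em⇒dne)
open import Data.Product using (Σ; _×_; _,_; proj₁; proj₂)
open import Data.Sum using (_⊎_; inj₁; inj₂)
open import Data.Empty using (⊥-elim)
open import Data.List using ([]; _∷_)
open import Data.List.Relation.Unary.Linked using ([-])
open import Data.List.Relation.Unary.Any using (here)
open import Data.List.Membership.Propositional using (_∈_)
open import Relation.Nullary using (¬_; Dec; yes; no)
open import Relation.Nullary.Decidable using (map′)
open import Relation.Binary.PropositionalEquality using (refl)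

⊆-refl : ∀ {B} → B ⊆ B
⊆-refl r b = b

⊆-trans : ∀ {B C D} → B ⊆ C → C ⊆ D → B ⊆ D
⊆-trans B⊆C C⊆D r b = C⊆D r (B⊆C r b)

Closure-mono : ∀ {B C p} → B ⊆ C → Closure B p → Closure C p
Closure-mono B⊆C (step r r∈B prems) = step r (B⊆C r r∈B) (λ q q∈ → Closure-mono B⊆C (prems q q∈))

Adm : Base → Base
Adm B r = (∀ q → q ∈ prems r → Closure B q) → Closure B (concl r)

⊆-Adm : ∀ B → B ⊆ Adm B
⊆-Adm B r r∈B = step r r∈B

Closure-Adm⇒Closure : ∀ B {p} → Closure (Adm B) p → Closure B p
Closure-Adm⇒Closure B (step r r∈Adm prems) = r∈Adm (λ q q∈ → Closure-Adm⇒Closure B (prems q q∈))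

Adm-consistent : ∀ {B} → Consistent B → Consistent (Adm B)
Adm-consistent {B} consB inc = consB (λ p → Closure-Adm⇒Closure B (inc p))

maximal⇒⊇ : ∀ {C F} → MaximallyConsistent C → Consistent F → C ⊆ F → F ⊆ C
maximal⇒⊇ {C} {F} (_ , maximal) consF C⊆F r r∈F with maximal r
... | inj₁ r∈C = r∈C
... | inj₂ inc = ⊥-elim (consF (λ p → Closure-mono C∪r⊆F (inc p)))
  where
  C∪r⊆F : (C ∪｛ r ｝) ⊆ F
  C∪r⊆F r′ (inj₁ r′∈C) = C⊆F r′ r′∈C
  C∪r⊆F r′ (inj₂ refl) = r∈F

S5-reaches-maximal : ∀ {R C E D} → IsS5 R → MaximallyConsistent C → R E C →
                     Consistent D → E ⊆ D → Σ Base (λ F → F ⊆ C × R D F)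
S5-reaches-maximal {R} {C} {E} {D} S5 maxC REC consD E⊆D
  with IsS5.condC S5 E C REC D consD E⊆D
... | F , C⊆F , RDF = F , maximal⇒⊇ maxC consF C⊆F , RDF
  where
  consF : Consistent F
  consF = IsS5.condB S5 D consD F RDF

module Classical (em : ExcludedMiddle (suc 0ℓ)) where

  dne : DoubleNegationElimination (suc 0ℓ)
  dne = em⇒dne em

  decide : (P : Set) → Dec P
  decide P = map′ lower lift em

  ¬→⇒×¬ : {P Q : Set₁} → ¬ (P → Q) → P × ¬ Q
  ¬→⇒×¬ {P} ¬P→Q with em {P}
  ... | yes p = p , λ q → ¬P→Q (λ _ → q)
  ... | no ¬p = ⊥-elim (¬P→Q (λ p → ⊥-elim (¬p p)))

  counterexample : {X : Set₁} {P : X → Set} {Q : X → Set₁} →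
                   ¬ (∀ x → P x → Q x) → Σ X (λ x → P x × ¬ Q x)
  counterexample ¬∀ = dne λ ¬∃ → ¬∀ λ x p → dne λ ¬q → ¬∃ (x , p , ¬q)

  -- A rule outside Adm B has B-derivable premises and an underivable conclusion c, so
  -- adding it derives c, and every rule c ⇒ p lies in Adm B vacuously.
  Adm-maximallyConsistent : ∀ {B} → Consistent B → MaximallyConsistent (Adm B)
  Adm-maximallyConsistent {B} consB = Adm-consistent consB , maximal
    where
    maximal : ∀ δ → Adm B δ ⊎ Inconsistent (Adm B ∪｛ δ ｝)
    maximal δ with decide (Adm B δ)
    ... | yes δ∈Adm = inj₁ δ∈Adm
    ... | no δ∉Adm with decide (∀ q → q ∈ prems δ → Closure B q)
    ...   | no ¬prems = ⊥-elim (δ∉Adm (λ prems → ⊥-elim (¬prems prems)))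
    ...   | yes prems = inj₂ λ p → step (rule (concl δ ∷ []) [-] p) (inj₁ vacuous)
                                      λ { q (here refl) → derives-concl }
      where
      vacuous : ∀ {p} → Adm B (rule (concl δ ∷ []) [-] p)
      vacuous prem = ⊥-elim (δ∉Adm (λ _ → prem (concl δ) (here refl)))
      derives-concl : Closure (Adm B ∪｛ δ ｝) (concl δ)
      derives-concl = step δ (inj₂ refl)
        λ q q∈ → Closure-mono (λ r r∈ → inj₁ r∈) (Closure-mono (⊆-Adm B) (prems q q∈))

module _ {A : Set} (R : A → Relation) (S5 : ∀ a → IsS5 (R a)) where

  inconsistent⇒⊩ : ∀ φ {B} → Inconsistent B → ⊩ R B φ
  inconsistent⇒⊩ (atom p) inc = lift (inc p)
  inconsistent⇒⊩ ⊥'      inc p = lift (inc p)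
  inconsistent⇒⊩ (φ ⇒ ψ) inc C B⊆C _ = inconsistent⇒⊩ ψ (λ p → Closure-mono B⊆C (inc p))
  inconsistent⇒⊩ (K a φ) {B} inc C RBC = inconsistent⇒⊩ φ (proj₂ (IsS5.condA (S5 a) B inc) C RBC)

  ¬⊩⇒consistent : ∀ φ {B} → ¬ ⊩ R B φ → Consistent B
  ¬⊩⇒consistent φ ¬⊩ inc = ¬⊩ (inconsistent⇒⊩ φ inc)

  module _ (em : ExcludedMiddle (suc 0ℓ)) where
    open Classical em

    ⊩-mono : ∀ φ {B C} → B ⊆ C → ⊩ R B φ → ⊩ R C φ
    ⊩-mono (atom p) B⊆C ⊩B = lift (Closure-mono B⊆C (lower ⊩B))
    ⊩-mono ⊥'      B⊆C ⊩B p = lift (Closure-mono B⊆C (lower (⊩B p)))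
    ⊩-mono (φ ⇒ ψ) B⊆C ⊩B D C⊆D = ⊩B D (⊆-trans B⊆C C⊆D)
    ⊩-mono (K a φ) {B} {C} B⊆C ⊩B E RCE = dne λ ¬⊩E →
      let E′ , E′⊆E , RBE′ = IsS5.condD (S5 a) C E (¬⊩⇒consistent φ ¬⊩E) RCE B B⊆C
      in ¬⊩E (⊩-mono φ E′⊆E (⊩B E′ RBE′))

    ¬⊩-K-Adm : ∀ {a C E} φ → MaximallyConsistent C → R a C E → ¬ ⊩ R C φ →
               ¬ ⊩ R (Adm E) (K a φ)
    ¬⊩-K-Adm {a} {C} {E} φ maxC RCE ¬⊩C ⊩K
      with S5-reaches-maximal (S5 a) maxC REC (Adm-consistent consE) (⊆-Adm E)
      where
      REC : R a E C
      REC = IsS5.euclidean (S5 a) C E C RCE (IsS5.refl (S5 a) C)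
      consE : Consistent E
      consE = IsS5.condB (S5 a) C (proj₁ maxC) E RCE
    ... | F , F⊆C , RAdmEF = ¬⊩C (⊩-mono φ F⊆C (⊩K F RAdmEF))

    maximal-refutation : ∀ φ B → ¬ ⊩ R B φ →
                         Σ Base (λ C → MaximallyConsistent C × B ⊆ C × ¬ ⊩ R C φ)
    maximal-refutation (atom p) B ¬⊩ =
      Adm B , Adm-maximallyConsistent (¬⊩⇒consistent (atom p) ¬⊩) , ⊆-Adm B ,
      λ ⊩Adm → ¬⊩ (lift (Closure-Adm⇒Closure B (lower ⊩Adm)))
    maximal-refutation ⊥' B ¬⊩ =
      Adm B , Adm-maximallyConsistent (¬⊩⇒consistent ⊥' ¬⊩) , ⊆-Adm B ,
      λ ⊩Adm → ¬⊩ (λ p → lift (Closure-Adm⇒Closure B (lower (⊩Adm p))))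
    maximal-refutation (φ ⇒ ψ) B ¬⊩ with counterexample ¬⊩
    ... | C , B⊆C , ¬[φ→ψ] with ¬→⇒×¬ ¬[φ→ψ]
    ... | ⊩φ , ¬⊩ψ with maximal-refutation ψ C ¬⊩ψ
    ... | C′ , maxC′ , C⊆C′ , ¬⊩ψ′ =
      C′ , maxC′ , ⊆-trans B⊆C C⊆C′ , λ ⊩C′ → ¬⊩ψ′ (⊩C′ C′ ⊆-refl (⊩-mono φ C⊆C′ ⊩φ))
    maximal-refutation (K a φ) B ¬⊩ with counterexample ¬⊩
    ... | C , RBC , ¬⊩φ with maximal-refutation φ C ¬⊩φ
    ... | C′ , maxC′ , C⊆C′ , ¬⊩φ′ with IsS5.condC (S5 a) C B RCB C′ (proj₁ maxC′) C⊆C′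
      where
      RCB : R a C B
      RCB = IsS5.euclidean (S5 a) B C B RBC (IsS5.refl (S5 a) B)
    ... | E , B⊆E , RC′E =
      Adm E , Adm-maximallyConsistent (IsS5.condB (S5 a) C′ (proj₁ maxC′) E RC′E) ,
      ⊆-trans B⊆E (⊆-Adm E) , ¬⊩-K-Adm φ maxC′ RC′E ¬⊩φ′

lemma4p8 : ExcludedMiddle (suc 0ℓ) →
    (A : Set) → A →
    (R : A → Relation) → (∀ a → IsS5 (R a)) →
    (φ : Formula A) (B : Base) → ¬ ⊩ R B φ →
    Σ Base (λ C → MaximallyConsistent C × B ⊆ C × ¬ ⊩ R C φ)
lemma4p8 em A _ R S5 = maximal-refutation R S5 em
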